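{- Let $\rho\subset\mathbb{Z}_+^d$ be the shape of some $d$-dimensional partition. Then, as formal power series in $t,q$, $$\sum_{\pi \in \mathcal{P}^{(d)},\ \mathrm{sh}(\pi) \subseteq \rho} t^{\mathrm{cor}(\pi)} q^{|\pi|_{ch}} = \prod_{(i_1,\ldots,i_d) \in \rho} \left( 1 - t q^{i_1 + \cdots + i_d - d + 1} \right)^{ -1},$$ $$\sum_{\pi \in \mathcal{P}^{(d)},\ \mathrm{sh}(\pi) = \rho} t^{\mathrm{cor}(\pi)} q^{|\pi|_{ch}} = t^{\mathrm{cr}(\rho)} q^{|\rho|_{cr}} \prod_{(i_1,\ldots,i_d) \in \rho} \left( 1 - t q^{i_1 + \cdots + i_d - d + 1} \right)^{ -1}.$$
   Context: $\mathbf{e}_\ell$ denote standard basis vectors. A $d$-dimensional partition is an array $\pi=(\pi_{i_1,\ldots,i_d})_{i_1,\ldots,i_d\ge 1}$ of nonnegative integers with finitely many nonzero entries, weakly decreasing in each coordinate ($\pi_{\mathbf{i}}\ge\pi_{\mathbf{j}}$ when $\mathbf{i}\le\mathbf{j}$ componentwise); $\mathcal{P}^{(d)}$ is their set. Its diagram is $D(\pi)=\{(i_1,\ldots,i_d,i)\in\mathbb{Z}_+^{d+1}: 1\le i\le\pi_{i_1,\ldots,i_d}\}$ and its shape is $\mathrm{sh}(\pi)=\{\mathbf{i}\in\mathbb{Z}_+^d:\pi_{\mathbf{i}}>0\}$. A shape of a $d$-dimensional partition is thus a finite subset $\rho\subset\mathbb{Z}_+^d$ closed downward under the componentwise order. Corners: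 $\mathrm{Cor}(\pi)=\{\mathbf{i}\in D(\pi):\mathbf{i}+\mathbf{e}_\ell\notin D(\pi)\ \forall \ell\in[d]\}$, $\mathrm{cor}(\pi)=|\mathrm{Cor}(\pi)|$. For $\mathbf{i}=(i_1,\ldots,i_d)$, $\mathrm{ch}(\mathbf{i})=i_1+\cdots+i_d-d+1$, and $|\pi|_{ch}=\sum_{(\mathbf{i},i_{d+1})\in\mathrm{Cor}(\pi)}\mathrm{ch}(\mathbf{i})$. For a shape $\rho$, its top corners are $\mathrm{Cr}(\rho)=\{\mathbf{i}\in\rho:\mathbf{i}+\mathbf{e}_\ell\notin\rho\ \forall\ell\in[d]\}$, $\mathrm{cr}(\rho)=|\mathrm{Cr}(\rho)|$ and $|\rho|_{cr}=\sum_{\mathbf{i}\in\mathrm{Cr}(\rho)}\mathrm{ch}(\mathbf{i})$. -}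

module Defs where

open import Data.Nat as ℕ using (ℕ; zero; suc; _≤_; _<_)
open import Data.Nat.Properties using () renaming (_≟_ to _≟ℕ_)
open import Data.Integer as ℤ using (ℤ)
open import Data.Fin using (Fin)
open import Data.Fin.Properties using (all?)
open import Data.Vec as V using (Vec; updateAt)
open import Data.Vec.Properties using (≡-dec)
open import Data.Vec.Relation.Binary.Pointwise.Inductive using (Pointwise)
open import Data.Nat.ListAction using () renaming (sum to sumℕ)
open import Data.List as L using (List; []; _∷_; length; map; filter; upTo; foldr)
open import Data.List.Membership.Propositional using (_∈_)
open import Data.List.Relation.Unary.All using (All)
open import Data.List.Relation.Unary.Any using (Any)
open import Data.List.Relation.Unary.AllPairs using (AllPairs)
open import Data.List.Relation.Unary.Unique.Propositional using (Unique)
open import Data.Product using (Σ; _×_; _,_; proj₁)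
open import Relation.Nullary using (¬_; ¬?)
open import Relation.Binary.PropositionalEquality using (_≡_)

-- Positions in ℤ₊^d.  CONVENTION: a position (i₁,…,i_d) ∈ ℤ₊^d is stored
-- as the vector (i₁-1,…,i_d-1) ∈ ℕ^d (0-based storage).

Pos : ℕ → Set
Pos d = Vec ℕ d

_≤ᵥ_ : ∀ {d} → Pos d → Pos d → Set
_≤ᵥ_ = Pointwise _≤_

_+e_ : ∀ {d} → Pos d → Fin d → Pos d
i +e ℓ = updateAt i ℓ suc

-- ch(i) = i₁ + ⋯ + i_d - d + 1 ; with 0-based storage j_k = i_k - 1
-- this is (j₁ + ⋯ + j_d) + 1.
ch : ∀ {d} → Pos d → ℕ
ch j = suc (V.sum j)

record Partition (d : ℕ) : Set where
  field
    val  : Pos d → ℕ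
    mono : ∀ {i j} → i ≤ᵥ j → val j ≤ val i
    fin  : Σ (List (Pos d)) λ S → ∀ i → 0 < val i → i ∈ S
open Partition public

-- cells (i, i_{d+1}) of the diagram D(π); i_{d+1} is 1-based
Cell : ℕ → Set
Cell d = Pos d × ℕ

InD : ∀ {d} → Partition d → Cell d → Set
InD π (i , k) = 1 ≤ k × k ≤ val π i

IsCorner : ∀ {d} → Partition d → Cell d → Set
IsCorner π (i , k) = InD π (i , k) × (∀ ℓ → ¬ InD π (i +e ℓ , k))

-- "cor(π) = a and |π|_ch = b": there is a duplicate-free list enumerating
-- exactly Cor(π), of length a and with ch-sum b.
CorStat : ∀ {d} → Partition d → ℕ → ℕ → Set
CorStat {d} π a b =
  Σ (List (Cell d)) λ C →
    Unique C × (∀ c → (c ∈ C → IsCorner π c) × (IsCorner π c → c ∈ C))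
    × length C ≡ a × sumℕ (map (λ c → ch (proj₁ c)) C) ≡ b

ShSub : ∀ {d} → Partition d → List (Pos d) → Set
ShSub π ρ = ∀ i → 0 < val π i → i ∈ ρ

ShEq : ∀ {d} → Partition d → List (Pos d) → Set
ShEq π ρ = ShSub π ρ × (∀ i → i ∈ ρ → 0 < val π i)

DownClosed : ∀ {d} → List (Pos d) → Set
DownClosed ρ = ∀ {i j} → j ∈ ρ → i ≤ᵥ j → i ∈ ρ

_≗ₚ_ : ∀ {d} → Partition d → Partition d → Set
π ≗ₚ σ = ∀ i → val π i ≡ val σ i

-- the set {π ∈ P^(d) : P π} has exactly n elements (up to ≗ₚ)
Counts : ∀ {d} → (Partition d → Set) → ℕ → Set
Counts {d} P n =
  Σ (List (Partition d)) λ Ls →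
    length Ls ≡ n × All P Ls × AllPairs (λ π σ → ¬ (π ≗ₚ σ)) Ls
    × (∀ π → P π → Any (λ σ → π ≗ₚ σ) Ls)

IsTop : ∀ {d} → List (Pos d) → Pos d → Set
IsTop ρ i = ∀ ℓ → ¬ (i +e ℓ ∈ ρ)

Cr : ∀ {d} → List (Pos d) → List (Pos d)
Cr {d} ρ = filter (λ i → all? (λ ℓ → ¬? ((i +e ℓ) ∈? ρ))) ρ
  where open import Data.List.Membership.DecPropositional (≡-dec {n = d} _≟ℕ_) using (_∈?_)

cr : ∀ {d} → List (Pos d) → ℕ
cr ρ = length (Cr ρ)

wcr : ∀ {d} → List (Pos d) → ℕ
wcr ρ = sumℕ (map ch (Cr ρ))

-- formal power series in t, q with integer coefficients:
-- F a b = coefficient of t^a q^b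

FPS : Set
FPS = ℕ → ℕ → ℤ

Σℤ : List ℤ → ℤ
Σℤ = foldr ℤ._+_ (ℤ.+ 0)

_⊛_ : FPS → FPS → FPS
(F ⊛ G) a b =
  Σℤ (map (λ a₁ → Σℤ (map (λ b₁ → F a₁ b₁ ℤ.* G (a ℕ.∸ a₁) (b ℕ.∸ b₁))
                          (upTo (suc b))))
          (upTo (suc a)))

monomial : ℕ → ℕ → FPS
monomial m n a b with a ≟ℕ m | b ≟ℕ n
... | Relation.Nullary.yes _ | Relation.Nullary.yes _ = ℤ.+ 1
... | _ | _ = ℤ.+ 0

one : FPS
one = monomial 0 0

_−ₛ_ : FPS → FPS → FPS
(F −ₛ G) a b = F a b ℤ.- G a b

prodFactors : ∀ {d} → List (Pos d) → FPS
prodFactors ρ = foldr (λ i acc → (one −ₛ monomial 1 (ch i)) ⊛ acc) one ρ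

toFPS : (ℕ → ℕ → ℕ) → FPS
toFPS F a b = ℤ.+ (F a b)

_≈ₛ_ : FPS → FPS → Set
F ≈ₛ G = ∀ a b → F a b ≡ G a b

{-# OPTIONS --safe #-}
module Submission where

-- A partition π with shape inside ρ is determined by its corner multiplicities
-- μ i = π_i − max_ℓ π_{i+e_ℓ} (i ∈ ρ), and every μ : ρ → ℕ arises, from the recursion
-- π_i = μ i + max_ℓ π_{i+e_ℓ} on ρ and π_i = 0 off ρ. The corners of π above i are the μ i
-- topmost cells of that column, so cor(π) = Σ μ i and |π|_ch = Σ μ i · ch(i): the sum over π
-- is the sum over all μ of ∏_{i∈ρ} (t q^{ch i})^{μ i}, which is ∏_{i∈ρ} (1 − t q^{ch i})^{-1}.
-- The shape is all of ρ exactly when μ ≥ 1 on the top corners of ρ, which multiplies that sum by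
-- t^{cr ρ} q^{|ρ|_cr}.

open import Defs
open import Data.Nat as ℕ using (ℕ; zero; suc; _≤_; _<_; z≤n; s≤s; _∸_; _⊔_; _≤?_)
import Data.Nat.Properties as ℕ
open import Data.Nat.ListAction using () renaming (sum to sumℕ)
open import Data.Nat.ListAction.Properties using (sum-++; sum-↭)
open import Data.Integer as ℤ using (ℤ; +_; _+_; _-_; _*_)
import Data.Integer.Properties as ℤ
open import Data.Integer.Solver using (module +-*-Solver)
open import Algebra.Properties.AbelianGroup ℤ.+-0-abelianGroup using (//-rightDividesʳ)
open import Data.Fin using (Fin) renaming (zero to fzero; suc to fsuc)
open import Data.Fin.Properties using (all?; any?)
open import Data.Vec as V using (_∷_)
open import Data.Vec.Properties using (≡-dec)
open import Data.Vec.Relation.Binary.Pointwise.Inductive as Pointwiseᵥ using ([]; _∷_)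
open import Data.List using (List; []; _∷_; map; _++_; length; foldr; filter; applyUpTo; upTo)
import Data.List.Properties as List
open import Data.List.Membership.Propositional using (_∈_)
open import Data.List.Membership.Propositional.Properties
  using (∈-map⁺; ∈-map⁻; ∈-++⁺ˡ; ∈-++⁺ʳ; ∈-++⁻; ∈-applyUpTo⁺; ∈-applyUpTo⁻)
open import Data.List.Membership.Propositional.Properties.WithK using (unique∧set⇒bag)
open import Data.List.Relation.Binary.BagAndSetEquality using (∼bag⇒↭)
open import Data.List.Relation.Binary.Permutation.Propositional using (_↭_)
open import Data.List.Relation.Binary.Permutation.Propositional.Properties using (↭-length; map⁺)
open import Data.List.Relation.Binary.Pointwise using (Pointwise; []; _∷_; Pointwise-length)
open import Data.List.Relation.Unary.All as All using (All)
import Data.List.Relation.Unary.All.Properties as All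
open import Data.List.Relation.Unary.AllPairs as AllPairs using (AllPairs; []; _∷_)
import Data.List.Relation.Unary.AllPairs.Properties as AllPairs
open import Data.List.Relation.Unary.Any as Any using (here; there)
open import Data.List.Relation.Unary.Unique.Propositional using (Unique)
import Data.List.Relation.Unary.Unique.Propositional.Properties as Unique
open import Data.Product using (Σ; Σ-syntax; ∃-syntax; _×_; _,_; proj₁; proj₂)
open import Data.Sum using (inj₁; inj₂)
open import Data.Empty using (⊥-elim)
open import Function using (_∘_; _on_; id; mk⇔; case_of_)
open import Relation.Binary.Bundles using (Setoid)
import Relation.Binary.Reasoning.Setoid
open import Relation.Binary.Definitions using (DecidableEquality)
open import Relation.Binary.PropositionalEquality
open import Relation.Nullary using (Dec; yes; no; ¬_; ¬?)

open +-*-Solver using (solve; _:+_; _:-_; _:*_; _:=_)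

-- Power series

sum< : (ℕ → ℤ) → ℕ → ℤ
sum< f zero    = + 0
sum< f (suc n) = f 0 + sum< (f ∘ suc) n

Σℤ-map-applyUpTo : ∀ (f : ℕ → ℤ) (g : ℕ → ℕ) n → Σℤ (map f (applyUpTo g n)) ≡ sum< (f ∘ g) n
Σℤ-map-applyUpTo f g zero    = refl
Σℤ-map-applyUpTo f g (suc n) = cong (_+_ (f (g 0))) (Σℤ-map-applyUpTo f (g ∘ suc) n)

Σℤ-map-upTo : ∀ f n → Σℤ (map f (upTo n)) ≡ sum< f n
Σℤ-map-upTo f = Σℤ-map-applyUpTo f id

sum<-cong : ∀ {f g} n → (∀ i → i < n → f i ≡ g i) → sum< f n ≡ sum< g n
sum<-cong zero    eq = refl
sum<-cong (suc n) eq = cong₂ _+_ (eq 0 (s≤s z≤n)) (sum<-cong n (λ i i<n → eq (suc i) (s≤s i<n)))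

sum<-zero : ∀ {f} n → (∀ i → i < n → f i ≡ + 0) → sum< f n ≡ + 0
sum<-zero zero    eq = refl
sum<-zero (suc n) eq = trans (cong₂ _+_ (eq 0 (s≤s z≤n)) (sum<-zero n (λ i i<n → eq (suc i) (s≤s i<n))))
                             (ℤ.+-identityˡ (+ 0))

sum<-snoc : ∀ f n → sum< f (suc n) ≡ sum< f n + f n
sum<-snoc f zero    = ℤ.+-comm (f 0) (+ 0)
sum<-snoc f (suc n) = trans (cong (_+_ (f 0)) (sum<-snoc (f ∘ suc) n)) (sym (ℤ.+-assoc (f 0) _ _))

sum<-+ : ∀ f m n → sum< f (m ℕ.+ n) ≡ sum< f m + sum< (λ i → f (m ℕ.+ i)) n
sum<-+ f zero    n = sym (ℤ.+-identityˡ _)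
sum<-+ f (suc m) n = trans (cong (_+_ (f 0)) (sum<-+ (f ∘ suc) m n)) (sym (ℤ.+-assoc (f 0) _ _))

sum<-− : ∀ f g n → sum< (λ i → f i - g i) n ≡ sum< f n - sum< g n
sum<-− f g zero    = refl
sum<-− f g (suc n) = trans (cong (_+_ (f 0 - g 0)) (sum<-− (f ∘ suc) (g ∘ suc) n))
  (solve 4 (λ a b c e → (a :- b) :+ (c :- e) := (a :+ c) :- (b :+ e)) refl
     (f 0) (g 0) (sum< (f ∘ suc) n) (sum< (g ∘ suc) n))

sum<-reverse : ∀ f n → sum< f (suc n) ≡ sum< (λ i → f (n ∸ i)) (suc n)
sum<-reverse f zero    = refl
sum<-reverse f (suc n) = begin
    f 0 + sum< (f ∘ suc) (suc n)
  ≡⟨ cong (_+_ (f 0)) (sum<-reverse (f ∘ suc) n) ⟩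
    f 0 + sum< (λ i → f (suc (n ∸ i))) (suc n)
  ≡⟨ ℤ.+-comm (f 0) _ ⟩
    sum< (λ i → f (suc (n ∸ i))) (suc n) + f 0
  ≡⟨ cong₂ _+_ (sum<-cong (suc n) (λ i i≤n → cong f (sym (ℕ.+-∸-assoc 1 (ℕ.≤-pred i≤n)))))
               (cong f (sym (ℕ.n∸n≡0 (suc n)))) ⟩
    sum< (λ i → f (suc n ∸ i)) (suc n) + f (suc n ∸ suc n)
  ≡⟨ sym (sum<-snoc (λ i → f (suc n ∸ i)) (suc n)) ⟩
    sum< (λ i → f (suc n ∸ i)) (suc (suc n))
  ∎
  where open ≡-Reasoning

≈ₛ-setoid : Setoid _ _
≈ₛ-setoid = record
  { Carrier       = FPS
  ; _≈_           = _≈ₛ_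
  ; isEquivalence = record
    { refl  = λ a b → refl
    ; sym   = λ F≈G a b → sym (F≈G a b)
    ; trans = λ F≈G G≈H a b → trans (F≈G a b) (G≈H a b)
    }
  }

open Setoid ≈ₛ-setoid using ()
  renaming (refl to ≈ₛ-refl; sym to ≈ₛ-sym; trans to ≈ₛ-trans)

module ≈ₛ-Reasoning = Relation.Binary.Reasoning.Setoid ≈ₛ-setoid

cauchy : FPS → FPS → FPS
cauchy F G a b = sum< (λ a₁ → sum< (λ b₁ → F a₁ b₁ * G (a ∸ a₁) (b ∸ b₁)) (suc b)) (suc a)

⊛≡cauchy : ∀ F G a b → (F ⊛ G) a b ≡ cauchy F G a b
⊛≡cauchy F G a b =
  trans (Σℤ-map-upTo (λ a₁ → Σℤ (map (term a₁) (upTo (suc b)))) (suc a))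
        (sum<-cong (suc a) (λ a₁ _ → Σℤ-map-upTo (term a₁) (suc b)))
  where
  term : ℕ → ℕ → ℤ
  term a₁ b₁ = F a₁ b₁ * G (a ∸ a₁) (b ∸ b₁)

⊛-cong : ∀ {F F′ G G′} → F ≈ₛ F′ → G ≈ₛ G′ → (F ⊛ G) ≈ₛ (F′ ⊛ G′)
⊛-cong {F} {F′} {G} {G′} F≈F′ G≈G′ a b = begin
    (F ⊛ G) a b
  ≡⟨ ⊛≡cauchy F G a b ⟩
    cauchy F G a b
  ≡⟨ sum<-cong (suc a) (λ a₁ _ → sum<-cong (suc b) (λ b₁ _ →
       cong₂ _*_ (F≈F′ a₁ b₁) (G≈G′ (a ∸ a₁) (b ∸ b₁)))) ⟩
    cauchy F′ G′ a b
  ≡⟨ sym (⊛≡cauchy F′ G′ a b) ⟩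
    (F′ ⊛ G′) a b
  ∎
  where open ≡-Reasoning

cauchy-comm : ∀ F G a b → cauchy F G a b ≡ cauchy G F a b
cauchy-comm F G a b =
  trans (sum<-reverse (λ i → sum< (FG i) (suc b)) a) (sum<-cong (suc a) λ i i≤a →
    trans (sum<-reverse (FG (a ∸ i)) b) (sum<-cong (suc b) λ j j≤b →
      trans (cong₂ (λ x y → F (a ∸ i) (b ∸ j) * G x y)
                   (ℕ.m∸[m∸n]≡n (ℕ.≤-pred i≤a)) (ℕ.m∸[m∸n]≡n (ℕ.≤-pred j≤b)))
            (ℤ.*-comm (F (a ∸ i) (b ∸ j)) (G i j))))
  where
  FG : ℕ → ℕ → ℤ
  FG i j = F i j * G (a ∸ i) (b ∸ j)

⊛-comm : ∀ F G → (F ⊛ G) ≈ₛ (G ⊛ F)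
⊛-comm F G a b = trans (⊛≡cauchy F G a b) (trans (cauchy-comm F G a b) (sym (⊛≡cauchy G F a b)))

⊛-identityˡ : ∀ G → (one ⊛ G) ≈ₛ G
⊛-identityˡ G a b = begin
    (one ⊛ G) a b
  ≡⟨ ⊛≡cauchy one G a b ⟩
    (+ 1 * G a b + sum< (λ b₁ → + 0) b) + sum< (λ a₁ → sum< (λ b₁ → + 0) (suc b)) a
  ≡⟨ cong₂ _+_ (cong₂ _+_ (ℤ.*-identityˡ (G a b)) (sum<-zero b (λ _ _ → refl)))
               (sum<-zero a (λ _ _ → sum<-zero (suc b) (λ _ _ → refl))) ⟩
    (G a b + + 0) + + 0
  ≡⟨ trans (ℤ.+-identityʳ _) (ℤ.+-identityʳ _) ⟩
    G a b
  ∎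
  where open ≡-Reasoning

⊛-distribʳ-−ₛ : ∀ F F′ G → ((F −ₛ F′) ⊛ G) ≈ₛ ((F ⊛ G) −ₛ (F′ ⊛ G))
⊛-distribʳ-−ₛ F F′ G a b = begin
    ((F −ₛ F′) ⊛ G) a b
  ≡⟨ ⊛≡cauchy (F −ₛ F′) G a b ⟩
    sum< (λ a₁ → sum< (λ b₁ → (F a₁ b₁ - F′ a₁ b₁) * G (a ∸ a₁) (b ∸ b₁)) (suc b)) (suc a)
  ≡⟨ sum<-cong (suc a) (λ a₁ _ → trans (sum<-cong {g = λ b₁ → FG F a₁ b₁ - FG F′ a₁ b₁} (suc b)
                                         (λ b₁ _ → *-distribʳ-− (F a₁ b₁) (F′ a₁ b₁) (G (a ∸ a₁) (b ∸ b₁))))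
                                       (sum<-− (FG F a₁) (FG F′ a₁) (suc b))) ⟩
    sum< (λ a₁ → sum< (FG F a₁) (suc b) - sum< (FG F′ a₁) (suc b)) (suc a)
  ≡⟨ sum<-− (λ a₁ → sum< (FG F a₁) (suc b)) (λ a₁ → sum< (FG F′ a₁) (suc b)) (suc a) ⟩
    cauchy F G a b - cauchy F′ G a b
  ≡⟨ sym (cong₂ _-_ (⊛≡cauchy F G a b) (⊛≡cauchy F′ G a b)) ⟩
    ((F ⊛ G) −ₛ (F′ ⊛ G)) a b
  ∎
  where
  open ≡-Reasoning
  FG : FPS → ℕ → ℕ → ℤ
  FG H a₁ b₁ = H a₁ b₁ * G (a ∸ a₁) (b ∸ b₁)
  *-distribʳ-− : ∀ x y z → (x - y) * z ≡ x * z - y * z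
  *-distribʳ-− = solve 3 (λ x y z → (x :- y) :* z := x :* z :- y :* z) refl

−ₛ-cong : ∀ {F F′ G G′} → F ≈ₛ F′ → G ≈ₛ G′ → (F −ₛ G) ≈ₛ (F′ −ₛ G′)
−ₛ-cong F≈F′ G≈G′ a b = cong₂ _-_ (F≈F′ a b) (G≈G′ a b)

when : ∀ {p} {P : Set p} → Dec P → ℤ → ℤ
when (yes _) x = x
when (no _)  x = + 0

when-yes : ∀ {p} {P : Set p} (P? : Dec P) x → P → when P? x ≡ x
when-yes (yes _) x _  = refl
when-yes (no ¬p) x p  = ⊥-elim (¬p p)

when-no : ∀ {p} {P : Set p} (P? : Dec P) x → ¬ P → when P? x ≡ + 0
when-no (yes p) x ¬p = ⊥-elim (¬p p)
when-no (no _)  x _  = refl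

when-− : ∀ {p} {P : Set p} (P? : Dec P) x y → when P? (x - y) ≡ when P? x - when P? y
when-− (yes _) x y = refl
when-− (no _)  x y = refl

-- shift n G = t q^n · G
shift : ℕ → FPS → FPS
shift n G zero    b = + 0
shift n G (suc a) b = when (n ≤? b) (G a (b ∸ n))

shift-cong : ∀ n {F G} → F ≈ₛ G → shift n F ≈ₛ shift n G
shift-cong n F≈G zero    b = refl
shift-cong n F≈G (suc a) b = cong (when (n ≤? b)) (F≈G a (b ∸ n))

shift-−ₛ : ∀ n F G → shift n (F −ₛ G) ≈ₛ (shift n F −ₛ shift n G)
shift-−ₛ n F G zero    b = refl
shift-−ₛ n F G (suc a) b = when-− (n ≤? b) _ _

shifted-convolution-low : ∀ n (f g : ℕ → ℤ) b → b < n →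
  sum< (λ b₁ → when (n ≤? b₁) (f (b₁ ∸ n)) * g (b ∸ b₁)) (suc b) ≡ + 0
shifted-convolution-low n f g b b<n = sum<-zero (suc b) (λ b₁ b₁≤b →
  cong (_* g (b ∸ b₁)) (when-no (n ≤? b₁) (f (b₁ ∸ n))
                              (λ n≤b₁ → ℕ.<⇒≱ b<n (ℕ.≤-trans n≤b₁ (ℕ.≤-pred b₁≤b)))))

shifted-convolution-high : ∀ n (f g : ℕ → ℤ) c →
  sum< (λ b₁ → when (n ≤? b₁) (f (b₁ ∸ n)) * g (n ℕ.+ c ∸ b₁)) (suc (n ℕ.+ c))
  ≡ sum< (λ j → f j * g (c ∸ j)) (suc c)
shifted-convolution-high n f g c = begin
    sum< term (suc (n ℕ.+ c))
  ≡⟨ cong (sum< term) (sym (ℕ.+-suc n c)) ⟩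
    sum< term (n ℕ.+ suc c)
  ≡⟨ sum<-+ term n (suc c) ⟩
    sum< term n + sum< (λ j → term (n ℕ.+ j)) (suc c)
  ≡⟨ cong₂ _+_
       (sum<-zero n (λ j j<n → cong (_* g (n ℕ.+ c ∸ j)) (when-no (n ≤? j) (f (j ∸ n)) (ℕ.<⇒≱ j<n))))
       (sum<-cong (suc c) (λ j _ → cong₂ _*_
         (trans (when-yes (n ≤? (n ℕ.+ j)) (f (n ℕ.+ j ∸ n)) (ℕ.m≤m+n n j)) (cong f (ℕ.m+n∸m≡n n j)))
         (cong g (ℕ.[m+n]∸[m+o]≡n∸o n c j)))) ⟩
    + 0 + sum< (λ j → f j * g (c ∸ j)) (suc c)
  ≡⟨ ℤ.+-identityˡ _ ⟩
    sum< (λ j → f j * g (c ∸ j)) (suc c)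
  ∎
  where
  open ≡-Reasoning
  term : ℕ → ℤ
  term b₁ = when (n ≤? b₁) (f (b₁ ∸ n)) * g (n ℕ.+ c ∸ b₁)

shift-⊛ : ∀ n F G → (shift n F ⊛ G) ≈ₛ shift n (F ⊛ G)
shift-⊛ n F G zero    b = trans (⊛≡cauchy (shift n F) G 0 b)
  (trans (ℤ.+-identityʳ _) (sum<-zero (suc b) (λ _ _ → refl)))
shift-⊛ n F G (suc a) b = trans (⊛≡cauchy (shift n F) G (suc a) b)
  (trans (cong (_+ rows b) (sum<-zero (suc b) (λ _ _ → refl)))
         (trans (ℤ.+-identityˡ (rows b)) (rows≡ b (n ≤? b))))
  where
  rows : ℕ → ℤ
  rows b = sum< (λ a₁ → sum< (λ b₁ → when (n ≤? b₁) (F a₁ (b₁ ∸ n)) * G (a ∸ a₁) (b ∸ b₁)) (suc b)) (suc a)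

  rows≡ : ∀ b (n≤?b : Dec (n ≤ b)) → rows b ≡ when n≤?b ((F ⊛ G) a (b ∸ n))
  rows≡ b (no n≰b)  =
    sum<-zero (suc a) (λ a₁ _ → shifted-convolution-low n (F a₁) (G (a ∸ a₁)) b (ℕ.≰⇒> n≰b))
  rows≡ b (yes n≤b) with c , refl ← ℕ.m≤n⇒∃[o]m+o≡n n≤b = begin
      rows (n ℕ.+ c)
    ≡⟨ sum<-cong (suc a) (λ a₁ _ → shifted-convolution-high n (F a₁) (G (a ∸ a₁)) c) ⟩
      cauchy F G a c
    ≡⟨ sym (⊛≡cauchy F G a c) ⟩
      (F ⊛ G) a c
    ≡⟨ cong ((F ⊛ G) a) (sym (ℕ.m+n∸m≡n n c)) ⟩
      (F ⊛ G) a (n ℕ.+ c ∸ n)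
    ∎
    where open ≡-Reasoning

−shift-⊛ : ∀ n F G → ((F −ₛ shift n F) ⊛ G) ≈ₛ ((F ⊛ G) −ₛ shift n (F ⊛ G))
−shift-⊛ n F G = ≈ₛ-trans (⊛-distribʳ-−ₛ F (shift n F) G) (−ₛ-cong (≈ₛ-refl {F ⊛ G}) (shift-⊛ n F G))

monomial-diag : ∀ m k → monomial m k m k ≡ + 1
monomial-diag m k with m ℕ.≟ m | k ℕ.≟ k
... | yes _ | yes _ = refl
... | no m≢m | _    = ⊥-elim (m≢m refl)
... | yes _ | no k≢k = ⊥-elim (k≢k refl)

monomial-offˡ : ∀ m k a b → a ≢ m → monomial m k a b ≡ + 0
monomial-offˡ m k a b a≢m with a ℕ.≟ m | b ℕ.≟ k
... | yes a≡m | _ = ⊥-elim (a≢m a≡m)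
... | no _    | _ = refl

monomial-offʳ : ∀ m k a b → b ≢ k → monomial m k a b ≡ + 0
monomial-offʳ m k a b b≢k with a ℕ.≟ m | b ℕ.≟ k
... | _     | yes b≡k = ⊥-elim (b≢k b≡k)
... | yes _ | no _    = refl
... | no _  | no _    = refl

shift-monomial : ∀ n m k → shift n (monomial m k) ≈ₛ monomial (suc m) (n ℕ.+ k)
shift-monomial n m k zero b = sym (monomial-offˡ (suc m) (n ℕ.+ k) 0 b (λ ()))
shift-monomial n m k (suc a) b with n ≤? b
... | no n≰b = sym (monomial-offʳ (suc m) (n ℕ.+ k) (suc a) b (λ { refl → n≰b (ℕ.m≤m+n n k) }))
... | yes n≤b = compare (a ℕ.≟ m) ((b ∸ n) ℕ.≟ k)
  where
  compare : Dec (a ≡ m) → Dec (b ∸ n ≡ k) → monomial m k a (b ∸ n) ≡ monomial (suc m) (n ℕ.+ k) (suc a) b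
  compare (no a≢m) _ = trans (monomial-offˡ m k a (b ∸ n) a≢m)
                             (sym (monomial-offˡ (suc m) _ (suc a) b (a≢m ∘ ℕ.suc-injective)))
  compare (yes _) (no b∸n≢k) = trans (monomial-offʳ m k a (b ∸ n) b∸n≢k)
                             (sym (monomial-offʳ (suc m) _ (suc a) b (λ { refl → b∸n≢k (ℕ.m+n∸m≡n n k) })))
  compare (yes refl) (yes refl) = trans (monomial-diag a (b ∸ n))
                             (sym (subst (λ b′ → monomial (suc a) (n ℕ.+ (b ∸ n)) (suc a) b′ ≡ + 1)
                                         (ℕ.m+[n∸m]≡n n≤b) (monomial-diag (suc a) (n ℕ.+ (b ∸ n)))))

one−monomial-⊛ : ∀ n G → ((one −ₛ monomial 1 n) ⊛ G) ≈ₛ (G −ₛ shift n G)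
one−monomial-⊛ n G = ≈ₛ-trans (⊛-distribʳ-−ₛ one (monomial 1 n) G)
  (−ₛ-cong (⊛-identityˡ G) (≈ₛ-trans (⊛-cong monomial≈shift (≈ₛ-refl {G}))
                           (≈ₛ-trans (shift-⊛ n one G) (shift-cong n (⊛-identityˡ G)))))
  where
  monomial≈shift : monomial 1 n ≈ₛ shift n one
  monomial≈shift a b = sym (trans (shift-monomial n 0 0 a b) (cong (λ k → monomial 1 k a b) (ℕ.+-identityʳ n)))

shift^ : ℕ → ℕ → FPS → FPS
shift^ n zero    G = G
shift^ n (suc l) G = shift n (shift^ n l G)

shift^-cong : ∀ n l {F G} → F ≈ₛ G → shift^ n l F ≈ₛ shift^ n l G
shift^-cong n zero    F≈G = F≈G
shift^-cong n (suc l) F≈G = shift-cong n (shift^-cong n l F≈G)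

shift^-⊛ : ∀ n l F G → (shift^ n l F ⊛ G) ≈ₛ shift^ n l (F ⊛ G)
shift^-⊛ n zero    F G = ≈ₛ-refl
shift^-⊛ n (suc l) F G = ≈ₛ-trans (shift-⊛ n (shift^ n l F) G) (shift-cong n (shift^-⊛ n l F G))

shift^-monomial : ∀ n l m k → shift^ n l (monomial m k) ≈ₛ monomial (l ℕ.+ m) (l ℕ.* n ℕ.+ k)
shift^-monomial n zero    m k = ≈ₛ-refl
shift^-monomial n (suc l) m k = ≈ₛ-trans (shift-cong n (shift^-monomial n l m k))
  (≈ₛ-trans (shift-monomial n (l ℕ.+ m) (l ℕ.* n ℕ.+ k))
            (λ a b → cong (λ k′ → monomial (suc (l ℕ.+ m)) k′ a b) (sym (ℕ.+-assoc n (l ℕ.* n) k))))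

-- Counting multiplicity vectors

Table : Set
Table = ℕ → ℕ → List (List ℕ)

unit : Table
unit zero    zero    = [] ∷ []
unit zero    (suc b) = []
unit (suc a) b       = []

incHead : List ℕ → List ℕ
incHead []       = []
incHead (x ∷ xs) = suc x ∷ xs

keepIf : ∀ {p} {P : Set p} {B : Set} → Dec P → List B → List B
keepIf (yes _) xs = xs
keepIf (no _)  xs = []

-- atLeast n l R a b lists the x ∷ xs with l ≤ x and xs ∈ R (a ∸ x) (b ∸ x * n). Splitting on whether
-- x = l is what gives its counting series F the relation (1 - t q^n) F = (t q^n)^l (count R).
mutual
  atLeast : ℕ → ℕ → Table → Table
  atLeast n zero    R a b = map (0 ∷_) (R a b) ++ above n zero R a b
  atLeast n (suc l) R a b = above n l R a b

  above : ℕ → ℕ → Table → Table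
  above n l R zero    b = []
  above n l R (suc a) b = keepIf (n ≤? b) (map incHead (atLeast n l R a (b ∸ n)))

Extends : ℕ → ℕ → Table → ℕ → ℕ → List ℕ → Set
Extends n l R a b ys = ∃[ x ] ∃[ xs ] ∃[ a′ ] Σ[ b′ ∈ ℕ ]
  ys ≡ x ∷ xs × l ≤ x × a ≡ x ℕ.+ a′ × b ≡ x ℕ.* n ℕ.+ b′ × xs ∈ R a′ b′

keepIf⁻ : ∀ {p} {P : Set p} {B : Set} (P? : Dec P) {x : B} {xs} → x ∈ keepIf P? xs → P × x ∈ xs
keepIf⁻ (yes p) x∈xs = p , x∈xs

keepIf⁺ : ∀ {p} {P : Set p} {B : Set} (P? : Dec P) {x : B} {xs} → P → x ∈ xs → x ∈ keepIf P? xs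
keepIf⁺ (yes _) _ x∈xs = x∈xs
keepIf⁺ (no ¬p) p _    = ⊥-elim (¬p p)

mutual
  ∈-atLeast⁻ : ∀ n l R a b {ys} → ys ∈ atLeast n l R a b → Extends n l R a b ys
  ∈-atLeast⁻ n zero R a b ys∈ with ∈-++⁻ (map (0 ∷_) (R a b)) ys∈
  ... | inj₁ ys∈map with ∈-map⁻ (0 ∷_) ys∈map
  ...   | xs , xs∈R , refl = 0 , xs , a , b , refl , z≤n , refl , refl , xs∈R
  ∈-atLeast⁻ n zero R a b ys∈ | inj₂ ys∈above with ∈-above⁻ n zero R a b ys∈above
  ... | x , xs , a′ , b′ , eq , _ , eqa , eqb , xs∈R = x , xs , a′ , b′ , eq , z≤n , eqa , eqb , xs∈R
  ∈-atLeast⁻ n (suc l) R a b ys∈ = ∈-above⁻ n l R a b ys∈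

  ∈-above⁻ : ∀ n l R a b {ys} → ys ∈ above n l R a b → Extends n (suc l) R a b ys
  ∈-above⁻ n l R (suc a) b ys∈ with keepIf⁻ (n ≤? b) ys∈
  ... | n≤b , ys∈map with ∈-map⁻ incHead ys∈map
  ...   | zs , zs∈ , refl with ∈-atLeast⁻ n l R a (b ∸ n) zs∈
  ...     | x , xs , a′ , b′ , refl , l≤x , refl , eqb , xs∈R =
    suc x , xs , a′ , b′ , refl , s≤s l≤x , refl ,
    trans (sym (ℕ.m+[n∸m]≡n n≤b)) (trans (cong (n ℕ.+_) eqb) (sym (ℕ.+-assoc n (x ℕ.* n) b′))) , xs∈R

mutual
  ∈-atLeast⁺ : ∀ n l R {x xs a b} → l ≤ x → xs ∈ R a b →
               (x ∷ xs) ∈ atLeast n l R (x ℕ.+ a) (x ℕ.* n ℕ.+ b)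
  ∈-atLeast⁺ n zero    R {zero}      _         xs∈R = ∈-++⁺ˡ (∈-map⁺ (0 ∷_) xs∈R)
  ∈-atLeast⁺ n zero    R {suc x} {a = a} {b} _ xs∈R =
    ∈-++⁺ʳ (map (0 ∷_) (R (suc x ℕ.+ a) (suc x ℕ.* n ℕ.+ b))) (∈-above⁺ n zero R z≤n xs∈R)
  ∈-atLeast⁺ n (suc l) R {suc x} (s≤s l≤x) xs∈R = ∈-above⁺ n l R l≤x xs∈R

  ∈-above⁺ : ∀ n l R {x xs a b} → l ≤ x → xs ∈ R a b →
             (suc x ∷ xs) ∈ above n l R (suc x ℕ.+ a) (suc x ℕ.* n ℕ.+ b)
  ∈-above⁺ n l R {x} {xs} {a} {b} l≤x xs∈R =
    subst (λ b′ → (suc x ∷ xs) ∈ above n l R (suc x ℕ.+ a) b′) (sym (ℕ.+-assoc n (x ℕ.* n) b))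
      (keepIf⁺ (n ≤? (n ℕ.+ (x ℕ.* n ℕ.+ b))) (ℕ.m≤m+n n _)
        (∈-map⁺ incHead (subst (λ b′ → (x ∷ xs) ∈ atLeast n l R (x ℕ.+ a) b′)
                               (sym (ℕ.m+n∸m≡n n (x ℕ.* n ℕ.+ b)))
                               (∈-atLeast⁺ n l R l≤x xs∈R))))

incHead-injective : ∀ {xs ys} → incHead xs ≡ incHead ys → xs ≡ ys
incHead-injective {[]}    {[]}    _    = refl
incHead-injective {_ ∷ _} {_ ∷ _} refl = refl

keepIf-unique : ∀ {p} {P : Set p} {B : Set} (P? : Dec P) {xs : List B} → Unique xs → Unique (keepIf P? xs)
keepIf-unique (yes _) u = u
keepIf-unique (no _)  _ = []

mutual
  atLeast-unique : ∀ n l R → (∀ a b → Unique (R a b)) → ∀ a b → Unique (atLeast n l R a b)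
  atLeast-unique n zero R uR a b =
    Unique.++⁺ (Unique.map⁺ (λ { refl → refl }) (uR a b)) (above-unique n zero R uR a b) disjoint
    where
    disjoint : ∀ {v} → ¬ (v ∈ map (0 ∷_) (R a b) × v ∈ above n zero R a b)
    disjoint (v∈map , v∈above) with ∈-map⁻ (0 ∷_) v∈map | ∈-above⁻ n zero R a b v∈above
    ... | _ , _ , refl | _ , _ , _ , _ , refl , () , _
  atLeast-unique n (suc l) R uR a b = above-unique n l R uR a b

  above-unique : ∀ n l R → (∀ a b → Unique (R a b)) → ∀ a b → Unique (above n l R a b)
  above-unique n l R uR zero    b = []
  above-unique n l R uR (suc a) b =
    keepIf-unique (n ≤? b) (Unique.map⁺ incHead-injective (atLeast-unique n l R uR a (b ∸ n)))

count : Table → FPS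
count R a b = + length (R a b)

count-above : ∀ n l R → count (above n l R) ≈ₛ shift n (count (atLeast n l R))
count-above n l R zero    b = refl
count-above n l R (suc a) b with n ≤? b
... | yes _ = cong +_ (List.length-map incHead (atLeast n l R a (b ∸ n)))
... | no _  = refl

count-atLeast : ∀ n l R →
  (count (atLeast n l R) −ₛ shift n (count (atLeast n l R))) ≈ₛ shift^ n l (count R)
count-atLeast n zero R a b = begin
    + length (map (0 ∷_) (R a b) ++ above n zero R a b) - S
  ≡⟨ cong (λ k → + k - S) (trans (List.length-++ (map (0 ∷_) (R a b)))
                                 (cong (ℕ._+ length (above n zero R a b)) (List.length-map (0 ∷_) (R a b)))) ⟩
    + (length (R a b) ℕ.+ length (above n zero R a b)) - S
  ≡⟨ cong (_- S) (trans (ℤ.pos-+ (length (R a b)) _)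
                       (cong (_+_ (+ length (R a b))) (count-above n zero R a b))) ⟩
    (+ length (R a b) + S) - S
  ≡⟨ //-rightDividesʳ S (+ length (R a b)) ⟩
    + length (R a b)
  ∎
  where
  open ≡-Reasoning
  S : ℤ
  S = shift n (count (atLeast n zero R)) a b
count-atLeast n (suc l) R =
  ≈ₛ-trans (−ₛ-cong (count-above n l R) (shift-cong n (count-above n l R)))
  (≈ₛ-trans (≈ₛ-sym (shift-−ₛ n _ _)) (shift-cong n (count-atLeast n l R)))

∈-unit⁻ : ∀ a b {ms} → ms ∈ unit a b → ms ≡ [] × a ≡ 0 × b ≡ 0
∈-unit⁻ zero zero (here refl) = refl , refl , refl

unit-unique : ∀ a b → Unique (unit a b)
unit-unique zero    zero    = All.[] ∷ []
unit-unique zero    (suc b) = []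
unit-unique (suc a) b       = []

count-unit : count unit ≈ₛ one
count-unit zero    zero    = refl
count-unit zero    (suc b) = refl
count-unit (suc a) b       = refl

weight : ∀ {A : Set} → (A → ℕ) → List A → List ℕ → ℕ
weight w (c ∷ cs) (m ∷ ms) = m ℕ.* w c ℕ.+ weight w cs ms
weight w _        _        = 0

module Multiplicities {A : Set} (w lb : A → ℕ) where

  vectors : List A → Table
  vectors []       = unit
  vectors (c ∷ cs) = atLeast (w c) (lb c) (vectors cs)

  Bounded : List A → List ℕ → Set
  Bounded = Pointwise (λ c m → lb c ≤ m)

  factors : List A → FPS
  factors = foldr (λ c F → (one −ₛ monomial 1 (w c)) ⊛ F) one

  ∈-vectors⁻ : ∀ cs a b {ms} → ms ∈ vectors cs a b → Bounded cs ms × sumℕ ms ≡ a × weight w cs ms ≡ b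
  ∈-vectors⁻ [] a b ms∈ with ∈-unit⁻ a b ms∈
  ... | refl , refl , refl = [] , refl , refl
  ∈-vectors⁻ (c ∷ cs) a b ms∈ with ∈-atLeast⁻ (w c) (lb c) (vectors cs) a b ms∈
  ... | x , xs , a′ , b′ , refl , lb≤x , refl , refl , xs∈ with ∈-vectors⁻ cs a′ b′ xs∈
  ...   | bounded , refl , refl = lb≤x ∷ bounded , refl , refl

  ∈-vectors⁺ : ∀ {cs ms} → Bounded cs ms → ms ∈ vectors cs (sumℕ ms) (weight w cs ms)
  ∈-vectors⁺ []                  = here refl
  ∈-vectors⁺ {c ∷ _} (lb≤m ∷ bounded) = ∈-atLeast⁺ (w c) (lb c) _ lb≤m (∈-vectors⁺ bounded)

  vectors-unique : ∀ cs a b → Unique (vectors cs a b)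
  vectors-unique []       = unit-unique
  vectors-unique (c ∷ cs) = atLeast-unique (w c) (lb c) (vectors cs) (vectors-unique cs)

  count-vectors-⊛-factors : ∀ cs →
    (count (vectors cs) ⊛ factors cs) ≈ₛ monomial (sumℕ (map lb cs)) (weight w cs (map lb cs))
  count-vectors-⊛-factors []       = ≈ₛ-trans (⊛-cong count-unit (≈ₛ-refl {one})) (⊛-identityˡ one)
  count-vectors-⊛-factors (c ∷ cs) = begin
      X ⊛ ((one −ₛ monomial 1 n) ⊛ P)
    ≈⟨ ⊛-cong (≈ₛ-refl {X}) (one−monomial-⊛ n P) ⟩
      X ⊛ (P −ₛ shift n P)
    ≈⟨ ⊛-comm X _ ⟩
      (P −ₛ shift n P) ⊛ X
    ≈⟨ −shift-⊛ n P X ⟩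
      (P ⊛ X) −ₛ shift n (P ⊛ X)
    ≈⟨ −ₛ-cong (⊛-comm P X) (shift-cong n (⊛-comm P X)) ⟩
      (X ⊛ P) −ₛ shift n (X ⊛ P)
    ≈⟨ ≈ₛ-sym (−shift-⊛ n X P) ⟩
      (X −ₛ shift n X) ⊛ P
    ≈⟨ ⊛-cong (count-atLeast n l (vectors cs)) (≈ₛ-refl {P}) ⟩
      shift^ n l (count (vectors cs)) ⊛ P
    ≈⟨ shift^-⊛ n l _ P ⟩
      shift^ n l (count (vectors cs) ⊛ P)
    ≈⟨ shift^-cong n l (count-vectors-⊛-factors cs) ⟩
      shift^ n l (monomial (sumℕ (map lb cs)) (weight w cs (map lb cs)))
    ≈⟨ shift^-monomial n l _ _ ⟩
      monomial (sumℕ (map lb (c ∷ cs))) (weight w (c ∷ cs) (map lb (c ∷ cs)))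
    ∎
    where
    open ≈ₛ-Reasoning
    n l : ℕ
    n = w c
    l = lb c
    X P : FPS
    X = count (vectors (c ∷ cs))
    P = factors cs

-- Partitions from corner multiplicities

sum-+e : ∀ {d} (i : Pos d) ℓ → V.sum (i +e ℓ) ≡ suc (V.sum i)
sum-+e (x ∷ i) fzero    = refl
sum-+e (x ∷ i) (fsuc ℓ) = trans (cong (x ℕ.+_) (sum-+e i ℓ)) (ℕ.+-suc x (V.sum i))

≤ᵥ-refl : ∀ {d} {i : Pos d} → i ≤ᵥ i
≤ᵥ-refl = Pointwiseᵥ.refl ℕ.≤-refl

≤ᵥ-trans : ∀ {d} {i j k : Pos d} → i ≤ᵥ j → j ≤ᵥ k → i ≤ᵥ k
≤ᵥ-trans = Pointwiseᵥ.trans ℕ.≤-trans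

≤ᵥ-+e : ∀ {d} (i : Pos d) ℓ → i ≤ᵥ (i +e ℓ)
≤ᵥ-+e (x ∷ i) fzero    = ℕ.n≤1+n x ∷ ≤ᵥ-refl
≤ᵥ-+e (x ∷ i) (fsuc ℓ) = ℕ.≤-refl ∷ ≤ᵥ-+e i ℓ

antitone-if-steps-decrease : ∀ {d} (Q : Pos d → ℕ) → (∀ i ℓ → Q (i +e ℓ) ≤ Q i) →
                             ∀ {i j} → i ≤ᵥ j → Q j ≤ Q i
antitone-if-steps-decrease Q step [] = ℕ.≤-refl
antitone-if-steps-decrease Q step {x ∷ i} {y ∷ j} (x≤y ∷ i≤j) = ℕ.≤-trans
  (antitone-if-steps-decrease (λ k → Q (y ∷ k)) (λ k ℓ → step (y ∷ k) (fsuc ℓ)) i≤j)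
  (subst (λ z → Q (z ∷ i) ≤ Q (x ∷ i)) (ℕ.m∸n+n≡m x≤y) (along-head (y ∸ x)))
  where
  along-head : ∀ k → Q (k ℕ.+ x ∷ i) ≤ Q (x ∷ i)
  along-head zero    = ℕ.≤-refl
  along-head (suc k) = ℕ.≤-trans (step (k ℕ.+ x ∷ i) fzero) (along-head k)

maxOver : ∀ {d} → (Fin d → ℕ) → ℕ
maxOver {zero}  f = 0
maxOver {suc d} f = f fzero ⊔ maxOver (f ∘ fsuc)

≤-maxOver : ∀ {d} (f : Fin d → ℕ) ℓ → f ℓ ≤ maxOver f
≤-maxOver f fzero    = ℕ.m≤m⊔n _ _
≤-maxOver f (fsuc ℓ) = ℕ.≤-trans (≤-maxOver (f ∘ fsuc) ℓ) (ℕ.m≤n⊔m _ _)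

maxOver-lub : ∀ {d} (f : Fin d → ℕ) {k} → (∀ ℓ → f ℓ ≤ k) → maxOver f ≤ k
maxOver-lub {zero}  f f≤k = z≤n
maxOver-lub {suc d} f f≤k = ℕ.⊔-lub (f≤k fzero) (maxOver-lub (f ∘ fsuc) (f≤k ∘ fsuc))

maxOver-cong : ∀ {d} {f g : Fin d → ℕ} → (∀ ℓ → f ℓ ≡ g ℓ) → maxOver f ≡ maxOver g
maxOver-cong {zero}  f≡g = refl
maxOver-cong {suc d} f≡g = cong₂ _⊔_ (f≡g fzero) (maxOver-cong (f≡g ∘ fsuc))

maxOver-< : ∀ {d} (f : Fin d → ℕ) {k} → 0 < k → (∀ ℓ → f ℓ < k) → maxOver f < k
maxOver-< f {suc k} _ f<k = s≤s (maxOver-lub f (ℕ.≤-pred ∘ f<k))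

indicator : ∀ {p} {P : Set p} → Dec P → ℕ
indicator (yes _) = 1
indicator (no _)  = 0

sum-indicator : ∀ {A : Set} {P : A → Set} (P? : ∀ x → Dec (P x)) xs →
                sumℕ (map (indicator ∘ P?) xs) ≡ length (filter P? xs)
sum-indicator P? []       = refl
sum-indicator P? (x ∷ xs) with P? x
... | yes _ = cong suc (sum-indicator P? xs)
... | no _  = sum-indicator P? xs

weight-indicator : ∀ {A : Set} (w : A → ℕ) {P : A → Set} (P? : ∀ x → Dec (P x)) xs →
                   weight w xs (map (indicator ∘ P?) xs) ≡ sumℕ (map w (filter P? xs))
weight-indicator w P? []       = refl
weight-indicator w P? (x ∷ xs) with P? x
... | yes _ = cong₂ ℕ._+_ (ℕ.+-identityʳ (w x)) (weight-indicator w P? xs)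
... | no _  = weight-indicator w P? xs

sum-zeros : ∀ {A : Set} (xs : List A) → sumℕ (map (λ _ → 0) xs) ≡ 0
sum-zeros []       = refl
sum-zeros (_ ∷ xs) = sum-zeros xs

weight-zeros : ∀ {A : Set} (w : A → ℕ) xs → weight w xs (map (λ _ → 0) xs) ≡ 0
weight-zeros w []       = refl
weight-zeros w (_ ∷ xs) = weight-zeros w xs

∈⇒≤sum : ∀ {n ns} → n ∈ ns → n ≤ sumℕ ns
∈⇒≤sum (here refl)          = ℕ.m≤m+n _ _
∈⇒≤sum {ns = m ∷ _} (there n∈ns) = ℕ.≤-trans (∈⇒≤sum n∈ns) (ℕ.m≤n+m _ m)

same-elements⇒same-length-sum : ∀ {A : Set} {xs ys : List A} (f : A → ℕ) → Unique xs → Unique ys →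
  (∀ z → (z ∈ xs → z ∈ ys) × (z ∈ ys → z ∈ xs)) →
  length xs ≡ length ys × sumℕ (map f xs) ≡ sumℕ (map f ys)
same-elements⇒same-length-sum {xs = xs} {ys} f uxs uys same = ↭-length xs↭ys , sum-↭ (map⁺ f xs↭ys)
  where
  xs↭ys : xs ↭ ys
  xs↭ys = ∼bag⇒↭ (unique∧set⇒bag uxs uys (λ {z} → mk⇔ (proj₁ (same z)) (proj₂ (same z))))

AllPairs-map-within : ∀ {A B : Set} {R : A → A → Set} {S : B → B → Set} {Q : A → Set} (f : A → B) →
  (∀ {x y} → Q x → Q y → R x y → S (f x) (f y)) →
  ∀ {xs} → All Q xs → AllPairs R xs → AllPairs S (map f xs)
AllPairs-map-within {R = R} {S} {Q} f preserve qs rs = AllPairs.map⁺ (within qs rs)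
  where
  within : ∀ {xs} → All Q xs → AllPairs R xs → AllPairs (S on f) xs
  within All.[]         AllPairs.[]         = AllPairs.[]
  within (qx All.∷ qxs) (rxs AllPairs.∷ rs) =
    All.zipWith (λ (qy , rxy) → preserve qx qy rxy) (qxs , rxs) AllPairs.∷ within qxs rs

IsCorner-resp-≗ₚ : ∀ {d} {π σ : Partition d} → π ≗ₚ σ → ∀ {c} → IsCorner π c → IsCorner σ c
IsCorner-resp-≗ₚ π≗σ {i , k} ((1≤k , k≤π) , top) =
  (1≤k , subst (k ≤_) (π≗σ i) k≤π) ,
  λ ℓ (1≤k′ , k≤σ) → top ℓ (1≤k′ , subst (k ≤_) (sym (π≗σ (i +e ℓ))) k≤σ)

CorStat-resp-≗ₚ : ∀ {d} {π σ : Partition d} {a b} → π ≗ₚ σ → CorStat π a b → CorStat σ a b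
CorStat-resp-≗ₚ {π = π} {σ} π≗σ (C , uC , C≡Cor , lenC , chC) =
  C , uC ,
  (λ c → IsCorner-resp-≗ₚ {π = π} {σ} π≗σ ∘ proj₁ (C≡Cor c) ,
         proj₂ (C≡Cor c) ∘ IsCorner-resp-≗ₚ {π = σ} {π} (sym ∘ π≗σ)) ,
  lenC , chC

CorStat-functional : ∀ {d} {π : Partition d} {a b a′ b′} →
                     CorStat π a b → CorStat π a′ b′ → a ≡ a′ × b ≡ b′
CorStat-functional (C , uC , C≡Cor , refl , refl) (C′ , uC′ , C′≡Cor , refl , refl) =
  same-elements⇒same-length-sum (ch ∘ proj₁) uC uC′
    (λ c → proj₂ (C′≡Cor c) ∘ proj₁ (C≡Cor c) , proj₂ (C≡Cor c) ∘ proj₁ (C′≡Cor c))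

ShSub⇒val-∉ : ∀ {d} {π : Partition d} {ρ i} → ShSub π ρ → ¬ i ∈ ρ → val π i ≡ 0
ShSub⇒val-∉ {i = i} shape i∉ρ = ℕ.n≤0⇒n≡0 (ℕ.≮⇒≥ (i∉ρ ∘ shape i))

_≟ᵥ_ : ∀ {d} → DecidableEquality (Pos d)
_≟ᵥ_ = ≡-dec ℕ._≟_

assign : ∀ {d} → List (Pos d) → List ℕ → Pos d → ℕ
assign []       _        i = 0
assign (c ∷ cs) []       i = 0
assign (c ∷ cs) (m ∷ ms) i with i ≟ᵥ c
... | yes _ = m
... | no _  = assign cs ms i

assign-∷-≢ : ∀ {d} {c i : Pos d} {cs m ms} → i ≢ c → assign (c ∷ cs) (m ∷ ms) i ≡ assign cs ms i
assign-∷-≢ {c = c} {i} i≢c with i ≟ᵥ c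
... | yes i≡c = ⊥-elim (i≢c i≡c)
... | no _    = refl

assign-∷-≡ : ∀ {d} {c : Pos d} {cs m ms} → assign (c ∷ cs) (m ∷ ms) c ≡ m
assign-∷-≡ {c = c} with c ≟ᵥ c
... | yes _   = refl
... | no c≢c  = ⊥-elim (c≢c refl)

assign-map : ∀ {d} (μ : Pos d → ℕ) {cs i} → i ∈ cs → assign cs (map μ cs) i ≡ μ i
assign-map μ {c ∷ cs} {i} i∈ with i ≟ᵥ c | i∈
... | yes refl | _           = refl
... | no i≢c   | here i≡c    = ⊥-elim (i≢c i≡c)
... | no _     | there i∈cs  = assign-map μ i∈cs

map-assign : ∀ {d} {cs : List (Pos d)} {ms} → Unique cs → length ms ≡ length cs →
             map (assign cs ms) cs ≡ ms
map-assign {cs = []}     {[]}     _                 _   = refl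
map-assign {cs = c ∷ cs} {m ∷ ms} (c∉cs ∷ u) len = cong₂ _∷_ (assign-∷-≡ {c = c} {cs} {m} {ms})
  (trans (List.map-cong-local (All.map (λ c≢i → assign-∷-≢ {cs = cs} {m} {ms} (c≢i ∘ sym)) c∉cs))
         (map-assign u (ℕ.suc-injective len)))

Pointwise-assign : ∀ {d} {R : Pos d → ℕ → Set} {cs ms} →
                   Pointwise R cs ms → ∀ {i} → i ∈ cs → R i (assign cs ms i)
Pointwise-assign {R = R} {c ∷ cs} {m ∷ ms} (r ∷ rs) {i} i∈ with i ≟ᵥ c | i∈
... | yes refl | _          = r
... | no i≢c   | here i≡c   = ⊥-elim (i≢c i≡c)
... | no _     | there i∈cs = Pointwise-assign rs i∈cs

Pointwise-map⁺ : ∀ {d} {R : Pos d → ℕ → Set} (μ : Pos d → ℕ) {cs} →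
                 (∀ {i} → i ∈ cs → R i (μ i)) → Pointwise R cs (map μ cs)
Pointwise-map⁺ μ {[]}     R-μ = []
Pointwise-map⁺ μ {c ∷ cs} R-μ = R-μ (here refl) ∷ Pointwise-map⁺ μ (R-μ ∘ there)

column : ∀ {d} → Pos d → ℕ → ℕ → List (Cell d)
column c B m = applyUpTo (λ j → c , suc (B ℕ.+ j)) m

∈-column⁻ : ∀ {d} (c : Pos d) B m {i k} → (i , k) ∈ column c B m → i ≡ c × B < k × k ≤ B ℕ.+ m
∈-column⁻ c B m i,k∈ with ∈-applyUpTo⁻ (λ j → c , suc (B ℕ.+ j)) i,k∈
... | j , j<m , refl = refl , s≤s (ℕ.m≤m+n B j) , subst (_≤ B ℕ.+ m) (ℕ.+-suc B j) (ℕ.+-monoʳ-≤ B j<m)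

∈-column⁺ : ∀ {d} (c : Pos d) B m {k} → B < k → k ≤ B ℕ.+ m → (c , k) ∈ column c B m
∈-column⁺ c B m {k} B<k k≤ = subst (λ k′ → (c , k′) ∈ column c B m) (ℕ.m+[n∸m]≡n B<k)
  (∈-applyUpTo⁺ (λ j → c , suc (B ℕ.+ j)) (ℕ.+-cancelˡ-≤ B _ _
    (subst (_≤ B ℕ.+ m) (trans (sym (ℕ.m+[n∸m]≡n B<k)) (sym (ℕ.+-suc B (k ∸ suc B)))) k≤)))

column-unique : ∀ {d} (c : Pos d) B m → Unique (column c B m)
column-unique c B m = AllPairs.applyUpTo⁺₁ _ m
  (λ i<j _ eq → ℕ.<⇒≢ i<j (ℕ.+-cancelˡ-≡ B _ _ (ℕ.suc-injective (cong proj₂ eq))))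

ch-sum-column : ∀ {d} (c : Pos d) (g : ℕ → ℕ) m →
                sumℕ (map (ch ∘ proj₁) (applyUpTo (λ j → c , g j) m)) ≡ m ℕ.* ch c
ch-sum-column c g zero    = refl
ch-sum-column c g (suc m) = cong (ch c ℕ.+_) (ch-sum-column c (g ∘ suc) m)

module Construction {d : ℕ} (ρ : List (Pos d)) (ρ-closed : DownClosed ρ) where

  open import Data.List.Membership.DecPropositional (≡-dec {n = d} ℕ._≟_) using (_∈?_)

  -- Positions of ρ have coordinate sum below N, so N rounds of step reach the fixed point.
  N : ℕ
  N = suc (sumℕ (map V.sum ρ))

  ∈ρ⇒sum<N : ∀ {i} → i ∈ ρ → V.sum i < N
  ∈ρ⇒sum<N i∈ρ = s≤s (∈⇒≤sum (∈-map⁺ V.sum i∈ρ))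

  ∉ρ-if-sum-large : ∀ {i} → N ≤ V.sum i → ¬ i ∈ ρ
  ∉ρ-if-sum-large N≤sum i∈ρ = ℕ.<⇒≱ (∈ρ⇒sum<N i∈ρ) N≤sum

  step : (Pos d → ℕ) → (Pos d → ℕ) → Pos d → ℕ
  step μ Q i with i ∈? ρ
  ... | yes _ = μ i ℕ.+ maxOver (λ ℓ → Q (i +e ℓ))
  ... | no _  = 0

  step-∈ : ∀ μ Q {i} → i ∈ ρ → step μ Q i ≡ μ i ℕ.+ maxOver (λ ℓ → Q (i +e ℓ))
  step-∈ μ Q {i} i∈ρ with i ∈? ρ
  ... | yes _  = refl
  ... | no i∉ρ = ⊥-elim (i∉ρ i∈ρ)

  step-∉ : ∀ μ Q {i} → ¬ i ∈ ρ → step μ Q i ≡ 0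
  step-∉ μ Q {i} i∉ρ with i ∈? ρ
  ... | yes i∈ρ = ⊥-elim (i∉ρ i∈ρ)
  ... | no _    = refl

  step-cong : ∀ {μ μ′ Q Q′} i → (i ∈ ρ → μ i ≡ μ′ i) → (∀ ℓ → Q (i +e ℓ) ≡ Q′ (i +e ℓ)) →
              step μ Q i ≡ step μ′ Q′ i
  step-cong i μ≡μ′ Q≡Q′ with i ∈? ρ
  ... | yes i∈ρ = cong₂ ℕ._+_ (μ≡μ′ i∈ρ) (maxOver-cong Q≡Q′)
  ... | no _    = refl

  Recurrence : (Pos d → ℕ) → (Pos d → ℕ) → Set
  Recurrence μ Q = ∀ i → Q i ≡ step μ Q i

  approx : (Pos d → ℕ) → ℕ → Pos d → ℕ
  approx μ zero    i = 0
  approx μ (suc n) i = step μ (approx μ n) i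

  sum-large-+e : ∀ (i : Pos d) ℓ n → N ≤ V.sum i ℕ.+ suc n → N ≤ V.sum (i +e ℓ) ℕ.+ n
  sum-large-+e i ℓ n N≤ =
    subst (λ s → N ≤ s ℕ.+ n) (sym (sum-+e i ℓ)) (subst (N ≤_) (ℕ.+-suc (V.sum i) n) N≤)

  approx-stable : ∀ μ n i → N ≤ V.sum i ℕ.+ n → approx μ n i ≡ approx μ (suc n) i
  approx-stable μ zero    i N≤ = sym (step-∉ μ _ (∉ρ-if-sum-large (subst (N ≤_) (ℕ.+-identityʳ _) N≤)))
  approx-stable μ (suc n) i N≤ =
    step-cong i (λ _ → refl) (λ ℓ → approx-stable μ n (i +e ℓ) (sum-large-+e i ℓ n N≤))

  Recurrence⇒≡approx : ∀ {μ Q} → Recurrence μ Q → ∀ n i → N ≤ V.sum i ℕ.+ n → Q i ≡ approx μ n i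
  Recurrence⇒≡approx {μ} {Q} rec zero i N≤ =
    trans (rec i) (step-∉ μ Q (∉ρ-if-sum-large (subst (N ≤_) (ℕ.+-identityʳ _) N≤)))
  Recurrence⇒≡approx rec (suc n) i N≤ =
    trans (rec i) (step-cong i (λ _ → refl) λ ℓ →
      Recurrence⇒≡approx rec n (i +e ℓ) (sum-large-+e i ℓ n N≤))

  height : (Pos d → ℕ) → Pos d → ℕ
  height μ = approx μ N

  height-recurrence : ∀ μ → Recurrence μ (height μ)
  height-recurrence μ i = step-cong i (λ _ → refl) (λ ℓ → approx-stable μ (ℕ.pred N) (i +e ℓ)
    (subst (λ s → N ≤ s ℕ.+ ℕ.pred N) (sym (sum-+e i ℓ)) (s≤s (ℕ.m≤n+m _ (V.sum i)))))

  Recurrence⇒≡height : ∀ {μ Q} → Recurrence μ Q → ∀ i → Q i ≡ height μ i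
  Recurrence⇒≡height rec i = Recurrence⇒≡approx rec N i (ℕ.m≤n+m N (V.sum i))

  floor : (Pos d → ℕ) → Pos d → ℕ
  floor μ i = maxOver (λ ℓ → height μ (i +e ℓ))

  height-∈ : ∀ μ {i} → i ∈ ρ → height μ i ≡ floor μ i ℕ.+ μ i
  height-∈ μ {i} i∈ρ = trans (height-recurrence μ i) (trans (step-∈ μ (height μ) i∈ρ) (ℕ.+-comm (μ i) _))

  height-∉ : ∀ μ {i} → ¬ i ∈ ρ → height μ i ≡ 0
  height-∉ μ {i} i∉ρ = trans (height-recurrence μ i) (step-∉ μ (height μ) i∉ρ)

  height>0⇒∈ρ : ∀ μ i → 0 < height μ i → i ∈ ρ
  height>0⇒∈ρ μ i 0<h = case i ∈? ρ of λ where
    (yes i∈ρ) → i∈ρ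
    (no i∉ρ)  → ⊥-elim (ℕ.<⇒≢ 0<h (sym (height-∉ μ i∉ρ)))

  height-+e : ∀ μ i ℓ → height μ (i +e ℓ) ≤ height μ i
  height-+e μ i ℓ = case i ∈? ρ of λ where
    (yes i∈ρ) → subst (height μ (i +e ℓ) ≤_) (sym (height-∈ μ i∈ρ))
                      (ℕ.≤-trans (≤-maxOver _ ℓ) (ℕ.m≤m+n _ (μ i)))
    (no i∉ρ)  → ℕ.≤-reflexive (trans (height-∉ μ (i∉ρ ∘ λ i+eℓ∈ρ → ρ-closed i+eℓ∈ρ (≤ᵥ-+e i ℓ)))
                                      (sym (height-∉ μ i∉ρ)))

  partitionOf : (Pos d → ℕ) → Partition d
  partitionOf μ = record
    { val  = height μ
    ; mono = antitone-if-steps-decrease (height μ) (height-+e μ)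
    ; fin  = ρ , height>0⇒∈ρ μ
    }

  corner⇒ : ∀ μ {i k} → IsCorner (partitionOf μ) (i , k) →
            i ∈ ρ × floor μ i < k × k ≤ floor μ i ℕ.+ μ i
  corner⇒ μ {i} {k} ((1≤k , k≤h) , top) =
    i∈ρ , maxOver-< _ 1≤k (λ ℓ → ℕ.≰⇒> (λ k≤ → top ℓ (1≤k , k≤))) ,
    subst (k ≤_) (height-∈ μ i∈ρ) k≤h
    where
    i∈ρ : i ∈ ρ
    i∈ρ = height>0⇒∈ρ μ i (ℕ.<-≤-trans 1≤k k≤h)

  corner⇐ : ∀ μ {i k} → i ∈ ρ → floor μ i < k → k ≤ floor μ i ℕ.+ μ i →
            IsCorner (partitionOf μ) (i , k)
  corner⇐ μ {i} {k} i∈ρ floor<k k≤ =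
    (ℕ.≤-trans (s≤s z≤n) floor<k , subst (k ≤_) (sym (height-∈ μ i∈ρ)) k≤) ,
    λ ℓ (_ , k≤h) → ℕ.<⇒≱ (ℕ.≤-<-trans (≤-maxOver (λ ℓ′ → height μ (i +e ℓ′)) ℓ) floor<k) k≤h

  cornerList : (Pos d → ℕ) → List (Pos d) → List (Cell d)
  cornerList μ []       = []
  cornerList μ (c ∷ cs) = column c (floor μ c) (μ c) ++ cornerList μ cs

  ∈-cornerList⁻ : ∀ μ cs {i k} → (i , k) ∈ cornerList μ cs →
                  i ∈ cs × floor μ i < k × k ≤ floor μ i ℕ.+ μ i
  ∈-cornerList⁻ μ (c ∷ cs) i,k∈ with ∈-++⁻ (column c (floor μ c) (μ c)) i,k∈
  ... | inj₁ ∈column with ∈-column⁻ c (floor μ c) (μ c) ∈column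
  ...   | refl , floor<k , k≤ = here refl , floor<k , k≤
  ∈-cornerList⁻ μ (c ∷ cs) i,k∈ | inj₂ ∈rest with ∈-cornerList⁻ μ cs ∈rest
  ... | i∈cs , floor<k , k≤ = there i∈cs , floor<k , k≤

  ∈-cornerList⁺ : ∀ μ cs {i k} → i ∈ cs → floor μ i < k → k ≤ floor μ i ℕ.+ μ i →
                  (i , k) ∈ cornerList μ cs
  ∈-cornerList⁺ μ (c ∷ cs) (here refl) floor<k k≤ = ∈-++⁺ˡ (∈-column⁺ c (floor μ c) (μ c) floor<k k≤)
  ∈-cornerList⁺ μ (c ∷ cs) (there i∈cs) floor<k k≤ =
    ∈-++⁺ʳ (column c (floor μ c) (μ c)) (∈-cornerList⁺ μ cs i∈cs floor<k k≤)

  cornerList-unique : ∀ μ {cs} → Unique cs → Unique (cornerList μ cs)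
  cornerList-unique μ {[]}     _               = AllPairs.[]
  cornerList-unique μ {c ∷ cs} (c∉cs AllPairs.∷ u) =
    Unique.++⁺ (column-unique c (floor μ c) (μ c)) (cornerList-unique μ u) disjoint
    where
    disjoint : ∀ {v} → ¬ (v ∈ column c (floor μ c) (μ c) × v ∈ cornerList μ cs)
    disjoint {i , k} (∈column , ∈rest)
      with ∈-column⁻ c (floor μ c) (μ c) ∈column | ∈-cornerList⁻ μ cs ∈rest
    ... | refl , _ | i∈cs , _ = All.lookup c∉cs i∈cs refl

  length-cornerList : ∀ μ cs → length (cornerList μ cs) ≡ sumℕ (map μ cs)
  length-cornerList μ []       = refl
  length-cornerList μ (c ∷ cs) = trans (List.length-++ (column c (floor μ c) (μ c)))
    (cong₂ ℕ._+_ (List.length-applyUpTo _ (μ c)) (length-cornerList μ cs))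

  ch-sum-cornerList : ∀ μ cs → sumℕ (map (ch ∘ proj₁) (cornerList μ cs)) ≡ weight ch cs (map μ cs)
  ch-sum-cornerList μ []       = refl
  ch-sum-cornerList μ (c ∷ cs) = begin
      sumℕ (map (ch ∘ proj₁) (column c (floor μ c) (μ c) ++ cornerList μ cs))
    ≡⟨ cong sumℕ (List.map-++ (ch ∘ proj₁) (column c (floor μ c) (μ c)) (cornerList μ cs)) ⟩
      sumℕ (map (ch ∘ proj₁) (column c (floor μ c) (μ c)) ++ map (ch ∘ proj₁) (cornerList μ cs))
    ≡⟨ sum-++ (map (ch ∘ proj₁) (column c (floor μ c) (μ c))) _ ⟩
      sumℕ (map (ch ∘ proj₁) (column c (floor μ c) (μ c))) ℕ.+ sumℕ (map (ch ∘ proj₁) (cornerList μ cs))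
    ≡⟨ cong₂ ℕ._+_ (ch-sum-column c _ (μ c)) (ch-sum-cornerList μ cs) ⟩
      weight ch (c ∷ cs) (map μ (c ∷ cs))
    ∎
    where open ≡-Reasoning

  corStat-partitionOf : ∀ μ → Unique ρ →
                        CorStat (partitionOf μ) (sumℕ (map μ ρ)) (weight ch ρ (map μ ρ))
  corStat-partitionOf μ u =
    cornerList μ ρ , cornerList-unique μ u ,
    (λ { (i , k) →
      (λ ∈list → let (i∈ρ , floor<k , k≤) = ∈-cornerList⁻ μ ρ ∈list in corner⇐ μ i∈ρ floor<k k≤) ,
      (λ corner → let (i∈ρ , floor<k , k≤) = corner⇒ μ corner in ∈-cornerList⁺ μ ρ i∈ρ floor<k k≤) }) ,
    length-cornerList μ ρ , ch-sum-cornerList μ ρ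

  multiplicity : Partition d → Pos d → ℕ
  multiplicity π i = val π i ∸ maxOver (λ ℓ → val π (i +e ℓ))

  multiplicity-recurrence : ∀ π → ShSub π ρ → Recurrence (multiplicity π) (val π)
  multiplicity-recurrence π shape i = case i ∈? ρ of λ where
    (yes i∈ρ) → trans (sym (ℕ.m∸n+n≡m (maxOver-lub _ (λ ℓ → mono π (≤ᵥ-+e i ℓ)))))
                      (sym (step-∈ (multiplicity π) (val π) i∈ρ))
    (no i∉ρ)  → trans (ShSub⇒val-∉ {π = π} shape i∉ρ) (sym (step-∉ (multiplicity π) (val π) i∉ρ))

  ≗partitionOf-multiplicity : ∀ π → ShSub π ρ →
                              π ≗ₚ partitionOf (assign ρ (map (multiplicity π) ρ))
  ≗partitionOf-multiplicity π shape = Recurrence⇒≡height λ i →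
    trans (multiplicity-recurrence π shape i)
          (step-cong i (λ i∈ρ → sym (assign-map (multiplicity π) i∈ρ)) (λ _ → refl))

  multiplicity-partitionOf : ∀ μ {i} → i ∈ ρ → multiplicity (partitionOf μ) i ≡ μ i
  multiplicity-partitionOf μ {i} i∈ρ =
    trans (cong (_∸ floor μ i) (height-∈ μ i∈ρ)) (ℕ.m+n∸m≡n (floor μ i) (μ i))

  partitionOf-injective : Unique ρ → ∀ {ms ms′} → length ms ≡ length ρ → length ms′ ≡ length ρ →
                          partitionOf (assign ρ ms) ≗ₚ partitionOf (assign ρ ms′) → ms ≡ ms′
  partitionOf-injective u {ms} {ms′} len len′ same = begin
      ms
    ≡⟨ sym (map-assign u len) ⟩
      map (assign ρ ms) ρ
    ≡⟨ List.map-cong-local (All.tabulate λ {i} i∈ρ → begin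
         assign ρ ms i
       ≡⟨ sym (multiplicity-partitionOf (assign ρ ms) i∈ρ) ⟩
         multiplicity (partitionOf (assign ρ ms)) i
       ≡⟨ cong₂ _∸_ (same i) (maxOver-cong (same ∘ (i +e_))) ⟩
         multiplicity (partitionOf (assign ρ ms′)) i
       ≡⟨ multiplicity-partitionOf (assign ρ ms′) i∈ρ ⟩
         assign ρ ms′ i
       ∎) ⟩
      map (assign ρ ms′) ρ
    ≡⟨ map-assign u len′ ⟩
      ms′
    ∎
    where open ≡-Reasoning

  module Counting (u : Unique ρ) (lb : Pos d → ℕ) (Sh : Partition d → Set)
    (Sh⇒ShSub : ∀ {π} → Sh π → ShSub π ρ)
    (Sh-partitionOf : ∀ {ms} → Multiplicities.Bounded ch lb ρ ms → Sh (partitionOf (assign ρ ms)))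
    (Sh⇒lb≤multiplicity : ∀ π → Sh π → ∀ {i} → i ∈ ρ → lb i ≤ multiplicity π i) where

    open Multiplicities ch lb

    partitions : ℕ → ℕ → List (Partition d)
    partitions a b = map (partitionOf ∘ assign ρ) (vectors ρ a b)

    partitions-sound : ∀ a b → All (λ π → Sh π × CorStat π a b) (partitions a b)
    partitions-sound a b = All.map⁺ (All.tabulate sound)
      where
      sound : ∀ {ms} → ms ∈ vectors ρ a b →
              Sh (partitionOf (assign ρ ms)) × CorStat (partitionOf (assign ρ ms)) a b
      sound {ms} ms∈ with ∈-vectors⁻ ρ a b ms∈
      ... | bounded , refl , refl = Sh-partitionOf bounded ,
        subst₂ (CorStat (partitionOf (assign ρ ms))) (cong sumℕ eq) (cong (weight ch ρ) eq)
               (corStat-partitionOf (assign ρ ms) u)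
        where
        eq : map (assign ρ ms) ρ ≡ ms
        eq = map-assign u (sym (Pointwise-length bounded))

    partitions-distinct : ∀ a b → AllPairs (λ π σ → ¬ π ≗ₚ σ) (partitions a b)
    partitions-distinct a b = AllPairs-map-within (partitionOf ∘ assign ρ)
      (λ bounded bounded′ ms≢ms′ same → ms≢ms′
         (partitionOf-injective u (sym (Pointwise-length bounded)) (sym (Pointwise-length bounded′)) same))
      (All.tabulate (proj₁ ∘ ∈-vectors⁻ ρ a b)) (vectors-unique ρ a b)

    partitions-complete : ∀ a b π → Sh π × CorStat π a b → Any.Any (π ≗ₚ_) (partitions a b)
    partitions-complete a b π (shπ , corπ) =
      Any.map (λ { refl → π≗ }) (∈-map⁺ (partitionOf ∘ assign ρ) ms∈)
      where
      ms : List ℕ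
      ms = map (multiplicity π) ρ
      π≗ : π ≗ₚ partitionOf (assign ρ ms)
      π≗ = ≗partitionOf-multiplicity π (Sh⇒ShSub shπ)
      eq : map (assign ρ ms) ρ ≡ ms
      eq = map-assign u (List.length-map (multiplicity π) ρ)
      stats : sumℕ (map (assign ρ ms) ρ) ≡ a × weight ch ρ (map (assign ρ ms) ρ) ≡ b
      stats = CorStat-functional {π = partitionOf (assign ρ ms)} (corStat-partitionOf (assign ρ ms) u)
                                 (CorStat-resp-≗ₚ {π = π} {partitionOf (assign ρ ms)} π≗ corπ)
      ms∈ : ms ∈ vectors ρ a b
      ms∈ = subst₂ (λ a′ b′ → ms ∈ vectors ρ a′ b′)
                   (trans (cong sumℕ (sym eq)) (proj₁ stats)) (trans (cong (weight ch ρ) (sym eq)) (proj₂ stats))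
                   (∈-vectors⁺ (Pointwise-map⁺ (multiplicity π) (Sh⇒lb≤multiplicity π shπ)))

    counted : ∀ {m k} → sumℕ (map lb ρ) ≡ m → weight ch ρ (map lb ρ) ≡ k →
      Σ (ℕ → ℕ → ℕ) λ F → (∀ a b → Counts (λ π → Sh π × CorStat π a b) (F a b))
                          × ((toFPS F ⊛ prodFactors ρ) ≈ₛ monomial m k)
    counted m≡ k≡ = (λ a b → length (vectors ρ a b)) ,
      (λ a b → partitions a b , List.length-map _ (vectors ρ a b) ,
               partitions-sound a b , partitions-distinct a b , partitions-complete a b) ,
      ≈ₛ-trans (count-vectors-⊛-factors ρ) (λ a b → cong₂ (λ m k → monomial m k a b) m≡ k≡)

  isTop? : ∀ i → Dec (IsTop ρ i)
  isTop? i = all? (λ ℓ → ¬? ((i +e ℓ) ∈? ρ))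

  topFlag : Pos d → ℕ
  topFlag = indicator ∘ isTop?

  ≤top : ∀ n {i} → N ≤ V.sum i ℕ.+ n → i ∈ ρ → Σ[ c ∈ Pos d ] c ∈ ρ × i ≤ᵥ c × IsTop ρ c
  ≤top zero N≤ i∈ρ = ⊥-elim (∉ρ-if-sum-large (subst (N ≤_) (ℕ.+-identityʳ _) N≤) i∈ρ)
  ≤top (suc n) {i} N≤ i∈ρ with any? (λ ℓ → (i +e ℓ) ∈? ρ)
  ... | no ¬step = i , i∈ρ , ≤ᵥ-refl , λ ℓ i+eℓ∈ρ → ¬step (ℓ , i+eℓ∈ρ)
  ... | yes (ℓ , i+eℓ∈ρ) with ≤top n (sum-large-+e i ℓ n N≤) i+eℓ∈ρ
  ...   | c , c∈ρ , i+eℓ≤c , top = c , c∈ρ , ≤ᵥ-trans (≤ᵥ-+e i ℓ) i+eℓ≤c , top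

  ShEq-partitionOf : ∀ {ms} → Multiplicities.Bounded ch topFlag ρ ms → ShEq (partitionOf (assign ρ ms)) ρ
  ShEq-partitionOf {ms} bounded = height>0⇒∈ρ μ , λ i i∈ρ →
    let (c , c∈ρ , i≤c , top) = ≤top N (ℕ.m≤n+m N (V.sum i)) i∈ρ in
    ℕ.≤-trans (ℕ.≤-trans (flag≤ c∈ρ top) (subst (μ c ≤_) (sym (height-∈ μ c∈ρ)) (ℕ.m≤n+m (μ c) _)))
              (antitone-if-steps-decrease (height μ) (height-+e μ) i≤c)
    where
    μ : Pos d → ℕ
    μ = assign ρ ms
    flag≤ : ∀ {c} → c ∈ ρ → IsTop ρ c → 1 ≤ μ c
    flag≤ {c} c∈ρ top with isTop? c | Pointwise-assign bounded c∈ρ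
    ... | yes _   | 1≤μc = 1≤μc
    ... | no ¬top | _    = ⊥-elim (¬top top)

  topFlag≤multiplicity : ∀ π → ShEq π ρ → ∀ {i} → i ∈ ρ → topFlag i ≤ multiplicity π i
  topFlag≤multiplicity π (shape , filled) {i} i∈ρ with isTop? i
  ... | no _    = z≤n
  ... | yes top = subst (1 ≤_) (cong (val π i ∸_) (sym nothing-above)) (filled i i∈ρ)
    where
    nothing-above : maxOver (λ ℓ → val π (i +e ℓ)) ≡ 0
    nothing-above =
      ℕ.n≤0⇒n≡0 (maxOver-lub _ (λ ℓ → ℕ.≤-reflexive (ShSub⇒val-∉ {π = π} shape (top ℓ))))

theorem5p2 : (d : ℕ) (ρ : List (Pos d)) → Unique ρ → DownClosed ρ →
    (Σ (ℕ → ℕ → ℕ) λ F →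
        (∀ a b → Counts (λ π → ShSub π ρ × CorStat π a b) (F a b))
        × ((toFPS F ⊛ prodFactors ρ) ≈ₛ one))
    × (Σ (ℕ → ℕ → ℕ) λ G →
        (∀ a b → Counts (λ π → ShEq π ρ × CorStat π a b) (G a b))
        × ((toFPS G ⊛ prodFactors ρ) ≈ₛ monomial (cr ρ) (wcr ρ)))
theorem5p2 d ρ u ρ-closed =
  AnyShape.counted (sum-zeros ρ) (weight-zeros ch ρ) ,
  FullShape.counted (sum-indicator isTop? ρ) (weight-indicator ch isTop? ρ)
  where
  open Construction ρ ρ-closed
  module AnyShape  = Counting u (λ _ → 0) (λ π → ShSub π ρ) id (λ _ → height>0⇒∈ρ _) (λ _ _ _ → z≤n)
  module FullShape = Counting u topFlag (λ π → ShEq π ρ) proj₁ ShEq-partitionOf topFlag≤multiplicity
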